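{- Let $G$ be a finite digraph that is not strongly connected, and consider the sequence of inner diameters $d(G),d(LG),d(L^2G),\ldots$ of its iterated line digraphs. (i) If $G$ has no non-trivial strongly connected subdigraph, then there exists $h$ such that $d(L^hG)=0$ and $L^kG$ is empty for all $k>h$. (ii.a) If $G$ has a unique non-trivial strongly connected subdigraph $G'$ and $G'$ is a directed cycle, then the sequence $d(G),d(LG),d(L^2G),\ldots$ is eventually periodic. (ii.b) If $G$ has a non-trivial strongly connected subdigraph $G'$ that is not a directed cycle, then $d(L^kG)\to\infty$ as $k\to\infty$.
   Context: A digraph $G=(V,E)$ has a finite vertex set and a finite multiset of arcs (loops and multiple arcs allowed). $\mathrm{dist}_G(u,v)$ is the length of a shortest directed path from $u$ to $v$ ($\infty$ if none); the inner diameter is $d(G)=\max_{u,v\in V}\{\mathrm{dist}_G(u,v):\mathrm{dist}_G(u,v)<\infty\}$. The line digraph $LG$ has one vertex for each arc of $G$, with an arc from the vertex of arc $(u,v)$ to the vertex of arc $(w,z)$ if and only if $v=w$; iterated line digraphs are $L^0G=G$, $L^kG=L(L^{k-1}G)$. A non-trivial strongly connected subdigraph is a strongly connected subdigraph containing at least one arc. -}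

module Defs where

open import Data.Nat using (ℕ; zero; suc; _≤_; _<_; NonZero)
open import Data.Nat.DivMod using (_mod_)
open import Data.Fin using (Fin; toℕ; _≟_)
open import Data.Fin.Subset using (Subset; _∈_)
open import Data.List using (List; length; lookup; filter; allFin; concatMap; map)
open import Data.Product using (Σ; ∃; _×_; _,_; proj₁; proj₂)
open import Data.Unit using (⊤)
open import Data.Empty using (⊥)
open import Function.Definitions using (Injective)
open import Function.Bundles using (_⇔_)
open import Relation.Nullary using (¬_)
open import Relation.Binary.PropositionalEquality using (_≡_)

-- A finite digraph: vertices Fin n, arcs Fin m (a multiset of arcs,
-- loops and parallel arcs allowed), each arc with a source and a target.
record Digraph : Set where
  field
    n   : ℕ
    m   : ℕ
    src : Fin m → Fin n
    tgt : Fin m → Fin n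
open Digraph public

lineArcs : (G : Digraph) → List (Fin (m G) × Fin (m G))
lineArcs G = filter (λ p → tgt G (proj₁ p) ≟ src G (proj₂ p))
                    (concatMap (λ a → map (λ b → a , b) (allFin (m G))) (allFin (m G)))

L : Digraph → Digraph
L G = record
  { n   = m G
  ; m   = length (lineArcs G)
  ; src = λ i → proj₁ (lookup (lineArcs G) i)
  ; tgt = λ i → proj₂ (lookup (lineArcs G) i)
  }

L^ : ℕ → Digraph → Digraph
L^ zero    G = G
L^ (suc k) G = L (L^ k G)

data WalkVia (G : Digraph) (P : Fin (m G) → Set) : Fin (n G) → Fin (n G) → ℕ → Set where
  nil  : ∀ {u} → WalkVia G P u u 0
  cons : ∀ {v k} (a : Fin (m G)) → P a → WalkVia G P (tgt G a) v k →
         WalkVia G P (src G a) v (suc k)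

Walk : (G : Digraph) → Fin (n G) → Fin (n G) → ℕ → Set
Walk G = WalkVia G (λ _ → ⊤)

Dist : (G : Digraph) → Fin (n G) → Fin (n G) → ℕ → Set
Dist G u v k = Walk G u v k × (∀ j → j < k → ¬ Walk G u v j)

InnerDiam : Digraph → ℕ → Set
InnerDiam G D = (∃ λ u → ∃ λ v → Dist G u v D)
              × (∀ u v k → Dist G u v k → k ≤ D)

StronglyConnected : Digraph → Set
StronglyConnected G = ∀ u v → ∃ λ k → Walk G u v k

EmptyDigraph : Digraph → Set
EmptyDigraph G = Fin (n G) → ⊥

record SubDigraph (G : Digraph) : Set where
  field
    vs     : Subset (n G)
    as     : Subset (m G)
    closed : ∀ a → a ∈ as → (src G a ∈ vs) × (tgt G a ∈ vs)
open SubDigraph public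

NonTrivialSC : {G : Digraph} → SubDigraph G → Set
NonTrivialSC {G} H =
  (∀ u v → u ∈ vs H → v ∈ vs H → ∃ λ k → WalkVia G (λ a → a ∈ as H) u v k)
  × (∃ λ a → a ∈ as H)

SameSub : {G : Digraph} → SubDigraph G → SubDigraph G → Set
SameSub H H' = (vs H ≡ vs H') × (as H ≡ as H')

IsDirectedCycle : {G : Digraph} → SubDigraph G → Set
IsDirectedCycle {G} H =
  Σ ℕ λ k → Σ (Fin (suc k) → Fin (n G)) λ f → Σ (Fin (suc k) → Fin (m G)) λ g →
    Injective _≡_ _≡_ f × Injective _≡_ _≡_ g
    × (∀ v → (v ∈ vs H) ⇔ (∃ λ i → f i ≡ v))
    × (∀ a → (a ∈ as H) ⇔ (∃ λ i → g i ≡ a))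
    × (∀ i → src G (g i) ≡ f i)
    × (∀ i → tgt G (g i) ≡ f ((suc (toℕ i)) mod (suc k)))

{-# OPTIONS --safe #-}
-- An arc of L^k G is a walk of k + 1 arcs of G, and a walk of length j in
-- L^(k+1) G slides a window of k + 1 consecutive arcs along a walk of
-- length k + 1 + j in G; inner diameters of line digraphs are thus
-- maximal sliding distances between windows.
--
-- (i) Without cycles G has no walk of length n G, so L^k G has no vertex
-- for k > n G; the last non-empty L^h G has no arcs, so d(L^h G) = 0.
--
-- (ii.a) If the only non-trivial strong subdigraph is a directed cycle H,
-- a walk meets H within its first and its last n G arcs and runs around H
-- in between, so long windows are p-periodic away from their ends.
-- Inserting one period at position n G is then a bijection from windows of
-- length k to windows of length k + p which preserves sliding distances.
--
-- (ii.b) If H is not a cycle, two of its arcs a ≠ a′ leave the same vertex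
-- w. Let C be a closed walk through a and w avoiding a′: the window running
-- around C needs at least k + 1 slides to reach the window of length k + 1
-- which starts with a′ and then returns to w, so d(L^(k+1) G) ≥ k + 1.
module Submission where

open import Defs
open import Data.Nat using (ℕ; zero; suc; _≤_; _<_; _+_; _*_; _∸_; z≤n; s≤s; s≤s⁻¹)
open import Data.Nat.Properties
open import Data.Nat.Induction using (<-rec)
open import Data.Nat.GeneralisedArithmetic using (fold; fold-+)
open import Data.Nat.DivMod using (_mod_; _%_; _/_; m≡m%n+[m/n]*n; m%n<n)
open import Relation.Binary.Definitions using (tri<; tri≈; tri>)
open import Data.Fin using (Fin; toℕ) renaming (zero to fzero; suc to fsuc)
import Data.Fin.Properties as Finₚ
open import Data.Fin.Subset using (Subset; _∈_; ⋃; ⁅_⁆)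
import Data.Fin.Subset.Properties as Subsetₚ
open import Data.List using (List; []; _∷_; _++_; length; take; drop; head; map; concat; replicate; lookup; filter; allFin; concatMap; cartesianProduct)
open import Data.List.Properties
open import Data.List.Relation.Unary.All using (All; []; _∷_)
import Data.List.Relation.Unary.All as All
import Data.List.Relation.Unary.All.Properties as Allₚ
open import Data.List.Relation.Unary.Any using (here; there)
import Data.List.Relation.Unary.Any as Any
import Data.List.Relation.Unary.Any.Properties as Anyₚ
open import Data.List.Membership.Propositional using () renaming (_∈_ to _∈ₗ_)
import Data.List.Membership.Propositional.Properties as Membershipₚ
import Data.List.Relation.Unary.Unique.Propositional as Unique
open import Data.List.Relation.Unary.AllPairs using (_∷_)
import Data.List.Relation.Unary.Unique.Propositional.Properties as Uniqueₚ
open import Data.Product using (Σ; ∃; ∃₂; _×_; _,_; proj₁; proj₂)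
open import Data.Sum using (inj₁; inj₂)
open import Data.Maybe using (just)
open import Data.Maybe.Properties using (just-injective)
open import Data.Unit using (tt)
open import Data.Empty using (⊥; ⊥-elim)
open import Function using (_∘_; flip)
open import Function.Bundles using (_⇔_; mk⇔; Equivalence)
open import Function.Construct.Symmetry using (⇔-sym)
open import Function.Construct.Composition using (_⇔-∘_)
open import Relation.Nullary using (¬_; Dec; yes; no; ¬?; contradiction)
open import Relation.Nullary.Decidable using (_×-dec_; map′)
open import Relation.Unary using (Decidable)
open import Relation.Binary.PropositionalEquality using (_≡_; _≢_; refl; sym; trans; cong; cong₂; subst; subst₂; module ≡-Reasoning)

Least : (ℕ → Set) → ℕ → Set
Least P k = P k × (∀ j → j < k → ¬ P j)

Greatest : (ℕ → Set) → ℕ → Set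
Greatest P k = P k × (∀ j → P j → j ≤ k)

least : {P : ℕ → Set} → Decidable P → ∀ {i} → P i → ∃ (Least P)
least {P} P? {i} = <-rec (λ i → P i → ∃ (Least P)) search i
  where
  search : ∀ i → (∀ {j} → j < i → P j → ∃ (Least P)) → P i → ∃ (Least P)
  search i rec pi with anyUpTo? P? i
  ... | yes (j , j<i , pj) = rec j<i pj
  ... | no none            = i , pi , λ j j<i pj → none (j , j<i , pj)

greatest : {P : ℕ → Set} → Decidable P → ∀ {i} → P i → ∀ B → (∀ j → P j → j < B) → ∃ (Greatest P)
greatest P? pi zero    below = ⊥-elim (n≮0 (below _ pi))
greatest P? pi (suc B) below with P? B
... | yes pB = B , pB , λ j pj → s≤s⁻¹ (below j pj)
... | no ¬pB = greatest P? pi B λ j pj → ≤∧≢⇒< (s≤s⁻¹ (below j pj)) λ { refl → ¬pB pj }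

Fin? : ∀ k → Dec (Fin k)
Fin? zero    = no λ ()
Fin? (suc k) = yes fzero

module _ {A : Set} where

  lookup-injective : ∀ {xs : List A} → Unique.Unique xs → ∀ {i j} → lookup xs i ≡ lookup xs j → i ≡ j
  lookup-injective (_ ∷ _) {fzero} {fzero} _ = refl
  lookup-injective (x∉ ∷ _) {fzero} {fsuc j} x≡ = contradiction x≡ (All.lookup x∉ (Membershipₚ.∈-lookup j))
  lookup-injective (x∉ ∷ _) {fsuc i} {fzero} x≡ = contradiction (sym x≡) (All.lookup x∉ (Membershipₚ.∈-lookup i))
  lookup-injective (_ ∷ u) {fsuc i} {fsuc j} x≡ = cong fsuc (lookup-injective u x≡)

  length-take≤ : ∀ k (xs : List A) → k ≤ length xs → length (take k xs) ≡ k
  length-take≤ k xs k≤ = trans (length-take k xs) (m≤n⇒m⊓n≡m k≤)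

  take-take≤ : ∀ {i k} (xs : List A) → i ≤ k → take i (take k xs) ≡ take i xs
  take-take≤ {i = i} {k} xs i≤k = trans (take-take i k xs) (cong (λ l → take l xs) (m≤n⇒m⊓n≡m i≤k))

  take-++ˡ : ∀ k (xs ys : List A) → k ≤ length xs → take k (xs ++ ys) ≡ take k xs
  take-++ˡ zero    _        _  _         = refl
  take-++ˡ (suc k) (x ∷ xs) ys (s≤s k≤) = cong (x ∷_) (take-++ˡ k xs ys k≤)

  drop-++ˡ : ∀ (xs ys : List A) → drop (length xs) (xs ++ ys) ≡ ys
  drop-++ˡ []       _  = refl
  drop-++ˡ (_ ∷ xs) ys = drop-++ˡ xs ys

  ∈-take : ∀ {j k y ys} (xs : List A) → drop j xs ≡ y ∷ ys → j < k → y ∈ₗ take k xs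
  ∈-take {j = zero}  {suc k} (x ∷ xs) refl _         = here refl
  ∈-take {j = suc j} {suc k} (x ∷ xs) y∷≡ (s≤s j<k) = there (∈-take xs y∷≡ j<k)

  length-concat-replicate : ∀ {xs : List A} → 0 < length xs → ∀ r → r ≤ length (concat (replicate r xs))
  length-concat-replicate         0<xs zero    = z≤n
  length-concat-replicate {xs} 0<xs (suc r) =
    subst (suc r ≤_) (sym (length-++ xs)) (+-mono-≤ 0<xs (length-concat-replicate 0<xs r))

  take-suc-∷ʳ : ∀ p {a} (xs : List A) → just a ≡ head (drop p xs) → take (suc p) xs ≡ take p xs ++ a ∷ []
  take-suc-∷ʳ zero    (x ∷ _)  refl = refl
  take-suc-∷ʳ (suc p) (x ∷ xs) a≡   = cong (x ∷_) (take-suc-∷ʳ p xs a≡)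

  drop-head : ∀ p {a} (xs : List A) → just a ≡ head (drop p xs) → drop p xs ≡ a ∷ drop (suc p) xs
  drop-head zero    (x ∷ _)  refl = refl
  drop-head (suc p) (x ∷ xs) a≡   = drop-head p xs a≡

  rotate-take : ∀ p {a} (xs : List A) → just a ≡ head (drop p (a ∷ xs)) → take p (a ∷ xs) ++ a ∷ xs ≡ a ∷ take p xs ++ xs
  rotate-take zero    _       _   = refl
  rotate-take (suc p) {a} xs per = cong (a ∷_) (begin
    take p xs ++ a ∷ xs          ≡⟨ ++-assoc (take p xs) (a ∷ []) xs ⟨
    (take p xs ++ a ∷ []) ++ xs  ≡⟨ cong (_++ xs) (take-suc-∷ʳ p xs per) ⟨
    take (suc p) xs ++ xs        ∎)
    where open ≡-Reasoning

  rotate-drop : ∀ p {a} (xs : List A) → just a ≡ head (drop p (a ∷ xs)) → drop p (a ∷ xs) ≡ a ∷ drop p xs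
  rotate-drop zero    _  _   = refl
  rotate-drop (suc p) xs per = drop-head p xs per

  drop-∷ : ∀ q (xs : List A) → q < length xs → ∃₂ λ a ys → drop q xs ≡ a ∷ ys
  drop-∷ zero    (x ∷ xs) _         = x , xs , refl
  drop-∷ (suc q) (x ∷ xs) (s≤s q<) = drop-∷ q xs q<

  drop-∷⇒< : ∀ i {b ys} (xs : List A) → drop i xs ≡ b ∷ ys → i < length xs
  drop-∷⇒< zero    (x ∷ xs) _  = s≤s z≤n
  drop-∷⇒< (suc i) (x ∷ xs) d≡ = s≤s (drop-∷⇒< i xs d≡)

  drop-∷-length : ∀ i {k b ys} (xs : List A) → drop i xs ≡ b ∷ ys → i + k < length xs → k ≤ length ys
  drop-∷-length zero    (x ∷ xs) refl k<  = s≤s⁻¹ k<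
  drop-∷-length (suc i) (x ∷ xs) d≡   i+k< = drop-∷-length i xs d≡ (s≤s⁻¹ i+k<)

  take-length-++ : ∀ (xs ys : List A) k → take (length xs + k) (xs ++ ys) ≡ xs ++ take k ys
  take-length-++ []       ys k = refl
  take-length-++ (x ∷ xs) ys k = cong (x ∷_) (take-length-++ xs ys k)

InnerDiamOf : {X : Set} → (X → X → ℕ → Set) → ℕ → Set
InnerDiamOf R D = (∃ λ x → ∃ λ y → Least (R x y) D) × (∀ x y k → Least (R x y) k → k ≤ D)

Least-resp-⇔ : {P Q : ℕ → Set} → (∀ j → P j ⇔ Q j) → ∀ {k} → Least P k → Least Q k
Least-resp-⇔ P⇔Q (pk , below) = Equivalence.to (P⇔Q _) pk , λ j j<k qj → below j j<k (Equivalence.from (P⇔Q j) qj)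

innerDiamOf-transport : {X Y : Set} {R : X → X → ℕ → Set} {S : Y → Y → ℕ → Set} (C : X → Y → Set) →
                        (∀ x → ∃ (C x)) → (∀ y → ∃ λ x → C x y) →
                        (∀ {x x′ y y′} → C x y → C x′ y′ → ∀ j → R x x′ j ⇔ S y y′ j) →
                        ∀ {D} → InnerDiamOf R D → InnerDiamOf S D
innerDiamOf-transport C total onto resp ((x , x′ , dist) , bound) =
  (proj₁ (total x) , proj₁ (total x′) , Least-resp-⇔ (resp (proj₂ (total x)) (proj₂ (total x′))) dist) ,
  λ y y′ k dist′ → bound (proj₁ (onto y)) (proj₁ (onto y′)) k
                     (Least-resp-⇔ (λ j → ⇔-sym (resp (proj₂ (onto y)) (proj₂ (onto y′)) j)) dist′)

innerDiamOf-cong : {X Y : Set} {R : X → X → ℕ → Set} {S : Y → Y → ℕ → Set} (C : X → Y → Set) →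
                   (∀ x → ∃ (C x)) → (∀ y → ∃ λ x → C x y) →
                   (∀ {x x′ y y′} → C x y → C x′ y′ → ∀ j → R x x′ j ⇔ S y y′ j) →
                   ∀ D → InnerDiamOf R D ⇔ InnerDiamOf S D
innerDiamOf-cong C total onto resp D =
  mk⇔ (innerDiamOf-transport C total onto resp)
      (innerDiamOf-transport (flip C) onto total λ c c′ j → ⇔-sym (resp c c′ j))

innerDiamOf-≥ : {X : Set} {R : X → X → ℕ → Set} → (∀ x y → Decidable (R x y)) → ∀ {D x y i k} →
                InnerDiamOf R D → R x y i → (∀ j → j < k → ¬ R x y j) → k ≤ D
innerDiamOf-≥ R? {x = x} {y} {k = k} (_ , bound) rxy none with least (R? x y) rxy
... | d , dist with k ≤? d
...   | yes k≤d = ≤-trans k≤d (bound x y d dist)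
...   | no  k≰d = contradiction (proj₁ dist) (none d (≰⇒> k≰d))

⟦_⟧ : ∀ {k} → List (Fin k) → Subset k
⟦ xs ⟧ = ⋃ (map ⁅_⁆ xs)

∈⟦⟧⁺ : ∀ {k} {x : Fin k} {xs} → x ∈ₗ xs → x ∈ ⟦ xs ⟧
∈⟦⟧⁺ {xs = y ∷ _} (here refl) = Subsetₚ.x∈p∪q⁺ (inj₁ (Subsetₚ.x∈⁅x⁆ y))
∈⟦⟧⁺ {xs = y ∷ _} (there x∈) = Subsetₚ.x∈p∪q⁺ (inj₂ (∈⟦⟧⁺ x∈))

∈⟦⟧⁻ : ∀ {k} {x : Fin k} xs → x ∈ ⟦ xs ⟧ → x ∈ₗ xs
∈⟦⟧⁻ [] x∈ = contradiction x∈ Subsetₚ.∉⊥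
∈⟦⟧⁻ (y ∷ xs) x∈ with Subsetₚ.x∈p∪q⁻ ⁅ y ⁆ ⟦ xs ⟧ x∈
... | inj₁ x∈y  = here (Subsetₚ.x∈⁅y⁆⇒x≡y y x∈y)
... | inj₂ x∈xs = there (∈⟦⟧⁻ xs x∈xs)

All∈⟦⟧ : ∀ {k} (xs : List (Fin k)) → All (_∈ ⟦ xs ⟧) xs
All∈⟦⟧ xs = All.tabulate ∈⟦⟧⁺

-- Walks as lists of arcs

module ArcWalks (G : Digraph) where

  V Arc : Set
  V   = Fin (n G)
  Arc = Fin (m G)

  infixr 5 _∷⟨_⟩_
  data ArcWalk : V → V → List Arc → Set where
    []     : ∀ {u} → ArcWalk u u []
    _∷⟨_⟩_ : ∀ {u v s} a → src G a ≡ u → ArcWalk (tgt G a) v s → ArcWalk u v (a ∷ s)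

  Linked : List Arc → Set
  Linked s = ∃₂ λ u v → ArcWalk u v s

  src-head : ∀ {u v a s} → ArcWalk u v (a ∷ s) → src G a ≡ u
  src-head (_ ∷⟨ e ⟩ _) = e

  ++⁺ : ∀ {u v w s t} → ArcWalk u v s → ArcWalk v w t → ArcWalk u w (s ++ t)
  ++⁺ []             q = q
  ++⁺ (a ∷⟨ e ⟩ p) q = a ∷⟨ e ⟩ ++⁺ p q

  ++⁻ : ∀ {u w} s {t} → ArcWalk u w (s ++ t) → ∃ λ v → ArcWalk u v s × ArcWalk v w t
  ++⁻ []      p              = _ , [] , p
  ++⁻ (a ∷ s) (.a ∷⟨ e ⟩ p) with v , p₁ , p₂ ← ++⁻ s p = v , a ∷⟨ e ⟩ p₁ , p₂

  splitAt : ∀ {u w s} i → ArcWalk u w s → ∃ λ v → ArcWalk u v (take i s) × ArcWalk v w (drop i s)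
  splitAt {s = s} i p = ++⁻ (take i s) (subst (ArcWalk _ _) (sym (take++drop≡id i s)) p)

  Linked-take : ∀ {s} i → Linked s → Linked (take i s)
  Linked-take i (u , _ , p) = u , _ , proj₁ (proj₂ (splitAt i p))

  Linked-drop : ∀ {s} i → Linked s → Linked (drop i s)
  Linked-drop i (_ , v , p) = _ , v , proj₂ (proj₂ (splitAt i p))

  Linked-∷ : ∀ {a b s} → tgt G a ≡ src G b → Linked (b ∷ s) → Linked (a ∷ b ∷ s)
  Linked-∷ {a} a→b (_ , v , b ∷⟨ refl ⟩ p) = src G a , v , a ∷⟨ refl ⟩ b ∷⟨ sym a→b ⟩ p

  Linked-adjacent : ∀ {a b s} → Linked (a ∷ b ∷ s) → tgt G a ≡ src G b
  Linked-adjacent (_ , _ , a ∷⟨ _ ⟩ b ∷⟨ e ⟩ _) = sym e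

  walk⇒arcWalk : ∀ {P u v k} → WalkVia G P u v k → ∃ λ s → ArcWalk u v s × length s ≡ k × All P s
  walk⇒arcWalk nil = [] , [] , refl , []
  walk⇒arcWalk (cons a pa w) with s , p , refl , ps ← walk⇒arcWalk w = a ∷ s , a ∷⟨ refl ⟩ p , refl , pa ∷ ps

  arcWalk⇒walk : ∀ {P u v s} → ArcWalk u v s → All P s → WalkVia G P u v (length s)
  arcWalk⇒walk []              []       = nil
  arcWalk⇒walk (a ∷⟨ refl ⟩ p) (pa ∷ ps) = cons a pa (arcWalk⇒walk p ps)

  arcWalk⇒Walk : ∀ {u v s} → ArcWalk u v s → Walk G u v (length s)
  arcWalk⇒Walk {s = s} p = arcWalk⇒walk p (All.universal (λ _ → tt) s)

  vertexAt : ∀ {u v s} → ArcWalk u v s → Fin (suc (length s)) → V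
  vertexAt {u} _            fzero    = u
  vertexAt     (_ ∷⟨ _ ⟩ p) (fsuc i) = vertexAt p i

  splitAtVertex : ∀ {u v s} (p : ArcWalk u v s) i → ∃₂ λ s₁ s₂ →
                  s ≡ s₁ ++ s₂ × ArcWalk u (vertexAt p i) s₁ × ArcWalk (vertexAt p i) v s₂
  splitAtVertex p fzero = [] , _ , refl , [] , p
  splitAtVertex (a ∷⟨ e ⟩ p) (fsuc i) with s₁ , s₂ , refl , p₁ , p₂ ← splitAtVertex p i =
    a ∷ s₁ , s₂ , refl , a ∷⟨ e ⟩ p₁ , p₂

  record ClosedSubwalk (u v : V) (s : List Arc) : Set where
    field
      {x}                : V
      before cycle after : List Arc
      split              : s ≡ before ++ cycle ++ after
      walk-before        : ArcWalk u x before
      walk-cycle         : ArcWalk x x cycle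
      walk-after         : ArcWalk x v after
      cycle-nonempty     : 0 < length cycle

  ClosedSubwalk-∷ : ∀ {u v s} a → src G a ≡ u → ClosedSubwalk (tgt G a) v s → ClosedSubwalk u v (a ∷ s)
  ClosedSubwalk-∷ a e c = record
    { split = cong (a ∷_) split ; walk-before = a ∷⟨ e ⟩ walk-before
    ; walk-cycle = walk-cycle ; walk-after = walk-after ; cycle-nonempty = cycle-nonempty }
    where open ClosedSubwalk c

  revisit⇒closedSubwalk : ∀ {u v s} (p : ArcWalk u v s) i j → i Data.Fin.< j → vertexAt p i ≡ vertexAt p j →
                          ClosedSubwalk u v s
  revisit⇒closedSubwalk (a ∷⟨ e ⟩ p) fzero (fsuc j) _ u≡ with s₁ , s₃ , refl , p₁ , p₃ ← splitAtVertex p j =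
    record { split = refl ; walk-before = []
           ; walk-cycle = a ∷⟨ e ⟩ subst (λ z → ArcWalk _ z s₁) (sym u≡) p₁
           ; walk-after = subst (λ z → ArcWalk z _ s₃) (sym u≡) p₃ ; cycle-nonempty = s≤s z≤n }
  revisit⇒closedSubwalk (a ∷⟨ e ⟩ p) (fsuc i) (fsuc j) (s≤s i<j) vi≡vj =
    ClosedSubwalk-∷ a e (revisit⇒closedSubwalk p i j i<j vi≡vj)

  long⇒closedSubwalk : ∀ {u v s} → ArcWalk u v s → n G ≤ length s → ClosedSubwalk u v s
  long⇒closedSubwalk p n≤ with i , j , i<j , vi≡vj ← Finₚ.pigeonhole (s≤s n≤) (vertexAt p) =
    revisit⇒closedSubwalk p i j i<j vi≡vj

  shortcut : ∀ {u v s} → ArcWalk u v s → n G ≤ length s → ∃ λ t → ArcWalk u v t × length t < length s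
  shortcut p n≤ with record { before = s₁ ; cycle = s₂ ; after = s₃ ; split = refl ; walk-before = p₁
                            ; walk-after = p₃ ; cycle-nonempty = 0<s₂ } ← long⇒closedSubwalk p n≤ =
    s₁ ++ s₃ , ++⁺ p₁ p₃ , shorter
    where
    open ≤-Reasoning
    shorter : length (s₁ ++ s₃) < length (s₁ ++ s₂ ++ s₃)
    shorter = begin-strict
      length (s₁ ++ s₃)                ≡⟨ length-++ s₁ ⟩
      length s₁ + length s₃            <⟨ +-monoʳ-< (length s₁) (m<n+m (length s₃) 0<s₂) ⟩
      length s₁ + (length s₂ + length s₃) ≡⟨ cong (length s₁ +_) (length-++ s₂) ⟨
      length s₁ + length (s₂ ++ s₃)    ≡⟨ length-++ s₁ ⟨
      length (s₁ ++ s₂ ++ s₃)          ∎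

  distance<n : ∀ {u v k} → Dist G u v k → k < n G
  distance<n {k = k} (w , none) with k <? n G
  ... | yes k<n = k<n
  ... | no  k≮n with _ , p , refl , _ ← walk⇒arcWalk w with t , q , t<s ← shortcut p (≮⇒≥ k≮n) =
    contradiction (arcWalk⇒Walk q) (none (length t) t<s)

  walk? : ∀ u v → Decidable (Walk G u v)
  walk? u v zero with u Finₚ.≟ v
  ... | yes refl = yes nil
  ... | no  u≢v  = no λ { nil → u≢v refl }
  walk? u v (suc k) with Finₚ.any? (λ a → (src G a Finₚ.≟ u) ×-dec walk? (tgt G a) v k)
  ... | yes (a , refl , w) = yes (cons a tt w)
  ... | no  none           = no λ { (cons a _ w) → none (a , refl , w) }

  distance? : ∀ u v → Decidable (Dist G u v)
  distance? u v k = walk? u v k ×-dec map′ (λ f j j<k → f {j} j<k) (λ f {j} j<k → f j j<k)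
                                        (allUpTo? (λ j → ¬? (walk? u v j)) k)

  IsDistance : ℕ → Set
  IsDistance k = ∃₂ λ u v → Dist G u v k

  isDistance? : Decidable IsDistance
  isDistance? k = Finₚ.any? λ u → Finₚ.any? λ v → distance? u v k

  innerDiam-exists : V → ∃ (InnerDiam G)
  innerDiam-exists x
    with D , (u , v , dist) , maximal ← greatest isDistance? (x , x , nil , λ _ ()) (n G) (λ _ (_ , _ , d) → distance<n d) =
    D , (u , v , dist) , λ u v k dist → maximal k (u , v , dist)

  firstVisit : ∀ {u w s} → ArcWalk u w s → ∃ λ t → ArcWalk u w t × All (λ a → src G a ≢ w) t
  firstVisit [] = [] , [] , []
  firstVisit {u} {w} (a ∷⟨ e ⟩ p) with u Finₚ.≟ w | firstVisit p
  ... | yes refl | _                  = [] , [] , []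
  ... | no  u≢w  | t , q , t-avoids-w = a ∷ t , a ∷⟨ e ⟩ q , (λ a↦w → u≢w (trans (sym e) a↦w)) ∷ t-avoids-w

  power : ∀ {w s} → ArcWalk w w s → ∀ r → ArcWalk w w (concat (replicate r s))
  power p zero    = []
  power p (suc r) = ++⁺ p (power p r)

  vertices : V → List Arc → List V
  vertices u s = u ∷ map (tgt G) s

  src∈vertices : ∀ {u v s a} → ArcWalk u v s → a ∈ₗ s → src G a ∈ₗ vertices u s
  src∈vertices (_ ∷⟨ e ⟩ _) (here refl) = here e
  src∈vertices (_ ∷⟨ _ ⟩ p) (there a∈)  = there (src∈vertices p a∈)

  tgt∈vertices : ∀ {u s a} → a ∈ₗ s → tgt G a ∈ₗ vertices u s
  tgt∈vertices a∈ = there (Membershipₚ.∈-map⁺ (tgt G) a∈)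

  splitAtMember : ∀ {u v s x} → ArcWalk u v s → x ∈ₗ vertices u s →
                  ∃₂ λ s₁ s₂ → s ≡ s₁ ++ s₂ × ArcWalk u x s₁ × ArcWalk x v s₂
  splitAtMember p (here refl) = [] , _ , refl , [] , p
  splitAtMember (a ∷⟨ e ⟩ p) (there x∈) with s₁ , s₂ , refl , p₁ , p₂ ← splitAtMember p x∈ =
    a ∷ s₁ , s₂ , refl , a ∷⟨ e ⟩ p₁ , p₂

  span : ∀ {u v s} → ArcWalk u v s → SubDigraph G
  span {u} {s = s} p = record
    { vs = ⟦ vertices u s ⟧ ; as = ⟦ s ⟧
    ; closed = λ a a∈ → ∈⟦⟧⁺ (src∈vertices p (∈⟦⟧⁻ s a∈)) , ∈⟦⟧⁺ (tgt∈vertices (∈⟦⟧⁻ s a∈)) }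

  span-nonTrivialSC : ∀ {x s} (p : ArcWalk x x s) → 0 < length s → NonTrivialSC (span p)
  span-nonTrivialSC {x} {s@(a ∷ _)} p _ = strong , a , All.head (All∈⟦⟧ s)
    where
    strong : ∀ u v → u ∈ vs (span p) → v ∈ vs (span p) → ∃ λ k → WalkVia G (_∈ as (span p)) u v k
    strong u v u∈ v∈
      with s₁ , _ , s≡s₁s₂ , _   , u⇝x ← splitAtMember p (∈⟦⟧⁻ (vertices x s) u∈)
         | t₁ , _ , s≡t₁t₂ , x⇝v , _   ← splitAtMember p (∈⟦⟧⁻ (vertices x s) v∈) =
      _ , arcWalk⇒walk (++⁺ u⇝x x⇝v)
            (Allₚ.++⁺ (Allₚ.++⁻ʳ s₁ (subst (All _) s≡s₁s₂ (All∈⟦⟧ s)))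
                      (Allₚ.++⁻ˡ t₁ (subst (All _) s≡t₁t₂ (All∈⟦⟧ s))))

-- Iterated line digraphs

module LineDigraph (G : Digraph) where

  private
    adjacent? : (p : Fin (m G) × Fin (m G)) → Dec (tgt G (proj₁ p) ≡ src G (proj₂ p))
    adjacent? p = tgt G (proj₁ p) Finₚ.≟ src G (proj₂ p)

    pairs : List (Fin (m G) × Fin (m G))
    pairs = concatMap (λ a → map (λ b → a , b) (allFin (m G))) (allFin (m G))

    pairs≡ : ∀ (xs : List (Fin (m G))) → concatMap (λ a → map (λ b → a , b) (allFin (m G))) xs ≡ cartesianProduct xs (allFin (m G))
    pairs≡ []       = refl
    pairs≡ (x ∷ xs) = cong (map (λ b → x , b) (allFin (m G)) ++_) (pairs≡ xs)

    lineArcs≡ : lineArcs G ≡ filter adjacent? (cartesianProduct (allFin (m G)) (allFin (m G)))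
    lineArcs≡ = cong (filter adjacent?) (pairs≡ (allFin (m G)))

  L-linked : ∀ e → tgt G (src (L G) e) ≡ src G (tgt (L G) e)
  L-linked e = proj₂ (Membershipₚ.∈-filter⁻ adjacent? {xs = pairs} (Membershipₚ.∈-lookup e))

  L-arc : ∀ {a b} → tgt G a ≡ src G b → ∃ λ e → src (L G) e ≡ a × tgt (L G) e ≡ b
  L-arc {a} {b} a→b = Any.index ab∈ , cong proj₁ lookup≡ , cong proj₂ lookup≡
    where
    ab∈ : (a , b) ∈ₗ lineArcs G
    ab∈ = subst ((a , b) ∈ₗ_) (sym lineArcs≡)
            (Membershipₚ.∈-filter⁺ adjacent? (Membershipₚ.∈-cartesianProduct⁺ (Membershipₚ.∈-allFin a) (Membershipₚ.∈-allFin b)) a→b)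
    lookup≡ : lookup (lineArcs G) (Any.index ab∈) ≡ (a , b)
    lookup≡ = sym (Anyₚ.lookup-index ab∈)

  L-arc-injective : ∀ {e e′} → src (L G) e ≡ src (L G) e′ → tgt (L G) e ≡ tgt (L G) e′ → e ≡ e′
  L-arc-injective src≡ tgt≡ = lookup-injective unique (cong₂ _,_ src≡ tgt≡)
    where
    unique : Unique.Unique (lineArcs G)
    unique = subst Unique.Unique (sym lineArcs≡)
               (Uniqueₚ.filter⁺ adjacent? (Uniqueₚ.cartesianProduct⁺ (Uniqueₚ.allFin⁺ (m G)) (Uniqueₚ.allFin⁺ (m G))))

module Words (G : Digraph) where
  open ArcWalks G
  open LineDigraph using (L-linked; L-arc; L-arc-injective)

  firstArc : ∀ k → Fin (m (L^ k G)) → Arc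
  firstArc zero    a = a
  firstArc (suc k) e = firstArc k (src (L^ (suc k) G) e)

  word      : ∀ k → Fin (m (L^ k G)) → List Arc
  laterArcs : ∀ k → Fin (m (L^ k G)) → List Arc
  word k e = firstArc k e ∷ laterArcs k e
  laterArcs zero    _ = []
  laterArcs (suc k) e = word k (tgt (L^ (suc k) G) e)

  length-word : ∀ k e → length (word k e) ≡ suc k
  length-word zero    _ = refl
  length-word (suc k) e = cong suc (length-word k (tgt (L^ (suc k) G) e))

  word-src      : ∀ k e → word k (src (L^ (suc k) G) e) ≡ take (suc k) (word (suc k) e)
  laterArcs-src : ∀ k e → laterArcs k (src (L^ (suc k) G) e) ≡ take k (word k (tgt (L^ (suc k) G) e))
  word-src k e = cong (firstArc k (src (L^ (suc k) G) e) ∷_) (laterArcs-src k e)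
  laterArcs-src zero    e = refl
  laterArcs-src (suc k) e =
    trans (cong (word k) (L-linked (L^ (suc k) G) e)) (word-src k (tgt (L^ (suc (suc k)) G) e))

  firstArc-adjacent : ∀ k e → tgt G (firstArc k (src (L^ (suc k) G) e)) ≡ src G (firstArc k (tgt (L^ (suc k) G) e))
  firstArc-adjacent zero    e = L-linked G e
  firstArc-adjacent (suc k) e =
    trans (firstArc-adjacent k (src (L^ (suc (suc k)) G) e)) (cong (src G ∘ firstArc k) (L-linked (L^ (suc k) G) e))

  word-linked : ∀ k e → Linked (word k e)
  word-linked zero    a = src G a , tgt G a , a ∷⟨ refl ⟩ []
  word-linked (suc k) e = Linked-∷ (firstArc-adjacent k e) (word-linked k (tgt (L^ (suc k) G) e))

  word-injective : ∀ k {e e′} → word k e ≡ word k e′ → e ≡ e′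
  word-injective zero              = ∷-injectiveˡ
  word-injective (suc k) {e} {e′} w≡ = L-arc-injective (L^ k G)
    (word-injective k (trans (word-src k e) (trans (cong (take (suc k)) w≡) (sym (word-src k e′)))))
    (word-injective k (∷-injectiveʳ w≡))

  word-adjacent : ∀ k {a s x y} → Linked (a ∷ s) →
                  word k x ≡ take (suc k) (a ∷ s) → word k y ≡ take (suc k) s → tgt (L^ k G) x ≡ src (L^ k G) y
  word-adjacent zero {s = _ ∷ _} lk x≡ y≡
    rewrite ∷-injectiveˡ x≡ | ∷-injectiveˡ y≡ = Linked-adjacent lk
  word-adjacent (suc k) {s = s} {x} {y} _ x≡ y≡ = word-injective k (begin
    word k (tgt (L^ (suc k) G) x)          ≡⟨ ∷-injectiveʳ x≡ ⟩
    take (suc k) s                          ≡⟨ take-take≤ s (n≤1+n (suc k)) ⟨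
    take (suc k) (take (suc (suc k)) s)     ≡⟨ cong (take (suc k)) y≡ ⟨
    take (suc k) (word (suc k) y)           ≡⟨ word-src k y ⟨
    word k (src (L^ (suc k) G) y)           ∎)
    where open ≡-Reasoning

  word-onto : ∀ k {s} → Linked s → length s ≡ suc k → ∃ λ e → word k e ≡ s
  word-onto zero    {a ∷ []} _  refl = a , refl
  word-onto (suc k) {a ∷ s}  lk len
    with y , y≡ ← word-onto k (Linked-drop 1 lk) (suc-injective len)
       | x , x≡ ← word-onto k (Linked-take (suc k) lk) (length-take≤ (suc k) (a ∷ s) (≤-trans (n≤1+n _) (≤-reflexive (sym len))))
    with e , refl , refl ← L-arc (L^ k G) (word-adjacent k lk x≡ (trans y≡ (sym (take-all (suc k) s (≤-reflexive (suc-injective len)))))) =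
    e , cong₂ _∷_ (∷-injectiveˡ x≡) y≡

  Slide : ℕ → List Arc → List Arc → ℕ → Set
  Slide k P Q j = ∃ λ s → Linked s × length s ≡ k + j × take k s ≡ P × drop j s ≡ Q

  slide-∷ : ∀ k {e y j} → Slide (suc k) (word k (tgt (L^ (suc k) G) e)) (word k y) j →
            Slide (suc k) (word k (src (L^ (suc k) G) e)) (word k y) (suc j)
  slide-∷ k {e} {j = j} (b ∷ s , lk , len , prefix , suffix) =
    firstArc k (src (L^ (suc k) G) e) ∷ b ∷ s ,
    Linked-∷ (trans (firstArc-adjacent k e) (cong (src G) (sym (∷-injectiveˡ prefix)))) lk ,
    trans (cong suc len) (sym (+-suc (suc k) j)) ,
    cong (firstArc k (src (L^ (suc k) G) e) ∷_) later≡ ,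
    suffix
    where
    later≡ : take k (b ∷ s) ≡ laterArcs k (src (L^ (suc k) G) e)
    later≡ = trans (sym (take-take≤ (b ∷ s) (n≤1+n k))) (trans (cong (take k) prefix) (sym (laterArcs-src k e)))

  walk⇒slide : ∀ k {x y j} → Walk (L^ (suc k) G) x y j → Slide (suc k) (word k x) (word k y) j
  walk⇒slide k {x} nil =
    word k x , word-linked k x , trans (length-word k x) (sym (+-identityʳ _)) ,
    take-all (suc k) (word k x) (≤-reflexive (length-word k x)) , refl
  walk⇒slide k (cons e _ w) = slide-∷ k (walk⇒slide k w)

  slide⇒walk : ∀ k {x y} j → Slide (suc k) (word k x) (word k y) j → Walk (L^ (suc k) G) x y j
  slide⇒walk k {x} zero (s , _ , len , prefix , refl) =
    subst (λ z → Walk (L^ (suc k) G) x z 0)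
          (word-injective k (trans (sym prefix) (take-all (suc k) s (≤-reflexive (trans len (+-identityʳ _)))))) nil
  slide⇒walk k {x} {y} (suc j) (a ∷ s , lk , len , prefix , suffix)
    with len′ ← suc-injective (trans len (+-suc (suc k) j))
    with z , z≡ ← word-onto k (Linked-take (suc k) (Linked-drop 1 lk))
                               (length-take≤ (suc k) s (m+n≤o⇒m≤o (suc k) (≤-reflexive (sym len′))))
    with e , refl , refl ← L-arc (L^ k G) (word-adjacent k lk (sym prefix) z≡) =
    cons e tt (slide⇒walk k j (s , Linked-drop 1 lk , len′ , sym z≡ , suffix))

  walk⇔slide : ∀ k {x y} j → Walk (L^ (suc k) G) x y j ⇔ Slide (suc k) (word k x) (word k y) j
  walk⇔slide k j = mk⇔ (walk⇒slide k) (slide⇒walk k j)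

  Word : ℕ → Set
  Word k = Σ (List Arc) λ s → Linked s × length s ≡ k

  SlideWord : ∀ k → Word k → Word k → ℕ → Set
  SlideWord k P Q = Slide k (proj₁ P) (proj₁ Q)

  innerDiam⇔wordDiam : ∀ k D → InnerDiam (L^ (suc k) G) D ⇔ InnerDiamOf (SlideWord (suc k)) D
  innerDiam⇔wordDiam k = innerDiamOf-cong (λ e P → word k e ≡ proj₁ P)
    (λ e → (word k e , word-linked k e , length-word k e) , refl)
    (λ (_ , lk , len) → word-onto k lk len)
    (λ { refl refl → walk⇔slide k })

-- Digraphs without cycles

vertex-of-¬stronglyConnected : ∀ G → ¬ StronglyConnected G → Fin (n G)
vertex-of-¬stronglyConnected G ¬sc with Fin? (n G)
... | yes x = x
... | no ¬x = contradiction (λ u → contradiction u ¬x) ¬sc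

arcless⇒innerDiam0 : ∀ G → Fin (n G) → (Fin (m G) → ⊥) → InnerDiam G 0
arcless⇒innerDiam0 G x arcless = (x , x , nil , λ _ ()) , bound
  where
  bound : ∀ u v k → Dist G u v k → k ≤ 0
  bound u v zero    _                = z≤n
  bound u v (suc k) (cons a _ _ , _) = contradiction a arcless

module Acyclic (G : Digraph) (acyclic : ∀ (H : SubDigraph G) → ¬ NonTrivialSC H) where
  open ArcWalks G
  open Words G

  L^-empty : ∀ k → n G ≤ k → EmptyDigraph (L^ (suc k) G)
  L^-empty k n≤k e
    with _ , w ← proj₂ (word-linked k e)
    with record { walk-cycle = c ; cycle-nonempty = 0<c }
           ← long⇒closedSubwalk w (≤-trans n≤k (≤-trans (n≤1+n k) (≤-reflexive (sym (length-word k e))))) =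
    acyclic (span c) (span-nonTrivialSC c 0<c)

  L^-vertex⇒≤ : ∀ j → Fin (n (L^ j G)) → j ≤ n G
  L^-vertex⇒≤ zero    _ = z≤n
  L^-vertex⇒≤ (suc k) v with k <? n G
  ... | yes k<n = k<n
  ... | no  k≮n = contradiction v (L^-empty k (≮⇒≥ k≮n))

  eventually-empty : Fin (n G) → ∃ λ h → InnerDiam (L^ h G) 0 × (∀ k → h < k → EmptyDigraph (L^ k G))
  eventually-empty x
    with h , vertex , maximal ← greatest (Fin? ∘ n ∘ flip L^ G) {0} x (suc (n G)) (λ j v → s≤s (L^-vertex⇒≤ j v)) =
    h , arcless⇒innerDiam0 (L^ h G) vertex (λ e → <⇒≱ ≤-refl (maximal (suc h) e)) ,
    λ k h<k v → <⇒≱ h<k (maximal k v)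

-- Strong subdigraphs with out-degree one

OutDeterministic : {G : Digraph} → SubDigraph G → Set
OutDeterministic {G} H = ∀ {a b} → a ∈ as H → b ∈ as H → src G a ≡ src G b → a ≡ b

module _ {G : Digraph} (H : SubDigraph G) (H-sc : NonTrivialSC H) where
  open ArcWalks G

  walkIn : ∀ {x y} → x ∈ vs H → y ∈ vs H → ∃ λ s → ArcWalk x y s × All (_∈ as H) s
  walkIn x∈ y∈ with s , w , _ , s⊆H ← walk⇒arcWalk (proj₂ (proj₁ H-sc _ _ x∈ y∈)) = s , w , s⊆H

  outArc : ∀ {x} → x ∈ vs H → ∃ λ a → a ∈ as H × src G a ≡ x
  outArc x∈ with walkIn x∈ (proj₁ (closed H _ (proj₂ (proj₂ H-sc))))
  ... | []    , []          , _       = proj₁ (proj₂ H-sc) , proj₂ (proj₂ H-sc) , refl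
  ... | a ∷ _ , _ ∷⟨ e ⟩ _ , a∈ ∷ _ = a , a∈ , e

-- Following the unique out-arcs of H from a₀ runs through all of H and
-- returns to a₀.
module OutDeterministic⇒Cycle {G : Digraph} (H : SubDigraph G) (H-sc : NonTrivialSC H) (det : OutDeterministic H) where
  open ArcWalks G

  a₀ : Arc
  a₀ = proj₁ (proj₂ H-sc)

  a₀∈ : a₀ ∈ as H
  a₀∈ = proj₂ (proj₂ H-sc)

  next : Arc → Arc
  next a with tgt G a Subsetₚ.∈? vs H
  ... | yes t∈ = proj₁ (outArc H H-sc t∈)
  ... | no  _  = a

  next-spec : ∀ {a} → a ∈ as H → next a ∈ as H × src G (next a) ≡ tgt G a
  next-spec {a} a∈ with tgt G a Subsetₚ.∈? vs H
  ... | yes t∈ = proj₂ (outArc H H-sc t∈)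
  ... | no  t∉ = contradiction (proj₂ (closed H a a∈)) t∉

  next^ : ℕ → Arc → Arc
  next^ r a = fold a next r

  next^-∈ : ∀ {a} r → a ∈ as H → next^ r a ∈ as H
  next^-∈ zero    a∈ = a∈
  next^-∈ (suc r) a∈ = proj₁ (next-spec (next^-∈ r a∈))

  next^-suc : ∀ r a → next^ (suc r) a ≡ next^ r (next a)
  next^-suc r a = trans (cong (fold a next) (+-comm 1 r)) (fold-+ a next r)

  walk-follows-next : ∀ {a v s} → a ∈ as H → ArcWalk (src G a) v s → All (_∈ as H) s → v ≡ src G (next^ (length s) a)
  walk-follows-next a∈ [] [] = refl
  walk-follows-next {a} {s = _ ∷ s} a∈ (b ∷⟨ b↦ ⟩ w) (b∈ ∷ s⊆H) with refl ← det b∈ a∈ b↦ =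
    trans (walk-follows-next (proj₁ (next-spec a∈)) (subst (λ x → ArcWalk x _ _) (sym (proj₂ (next-spec a∈))) w) s⊆H)
          (cong (src G) (sym (next^-suc (length s) a)))

  Returns : ℕ → Set
  Returns r = next^ (suc r) a₀ ≡ a₀

  returns : ∃ Returns
  returns with s , w , s⊆H ← walkIn H H-sc (proj₂ (closed H a₀ a₀∈)) (proj₁ (closed H a₀ a₀∈)) =
    length s , det (next^-∈ (suc (length s)) a₀∈) a₀∈ (sym (trans back (cong (src G) (sym (next^-suc (length s) a₀)))))
    where
    back : src G a₀ ≡ src G (next^ (length s) (next a₀))
    back = walk-follows-next (proj₁ (next-spec a₀∈)) (subst (λ x → ArcWalk x _ s) (sym (proj₂ (next-spec a₀∈))) w) s⊆H

  module _ (d : ℕ) (d-least : Least Returns d) where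

    returns-multiple : ∀ q → next^ (q * suc d) a₀ ≡ a₀
    returns-multiple zero    = refl
    returns-multiple (suc q) =
      trans (fold-+ a₀ next (suc d)) (trans (cong (next^ (suc d)) (returns-multiple q)) (proj₁ d-least))

    next^-% : ∀ r → next^ r a₀ ≡ next^ (r % suc d) a₀
    next^-% r = begin
      next^ r a₀                                        ≡⟨ cong (λ i → next^ i a₀) (m≡m%n+[m/n]*n r (suc d)) ⟩
      next^ (r % suc d + r / suc d * suc d) a₀          ≡⟨ fold-+ a₀ next (r % suc d) ⟩
      next^ (r % suc d) (next^ (r / suc d * suc d) a₀) ≡⟨ cong (next^ (r % suc d)) (returns-multiple (r / suc d)) ⟩
      next^ (r % suc d) a₀                              ∎
      where open ≡-Reasoning

    g : Fin (suc d) → Arc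
    g i = next^ (toℕ i) a₀

    f : Fin (suc d) → V
    f i = src G (g i)

    g-∈ : ∀ i → g i ∈ as H
    g-∈ i = next^-∈ (toℕ i) a₀∈

    g-mod : ∀ r → g (r mod suc d) ≡ next^ r a₀
    g-mod r = trans (cong (λ i → next^ i a₀) (Finₚ.toℕ-fromℕ< (m%n<n r (suc d)))) (sym (next^-% r))

    g-injective< : ∀ {i j} → toℕ i < toℕ j → g i ≢ g j
    g-injective< {i} {j} i<j gi≡gj = proj₂ d-least (c + toℕ i) (subst (c + toℕ i <_) c+j≡d (+-monoʳ-< c i<j)) returns′
      where
      c : ℕ
      c = d ∸ toℕ j
      c+j≡d : c + toℕ j ≡ d
      c+j≡d = m∸n+n≡m (s≤s⁻¹ (Finₚ.toℕ<n j))
      returns′ : Returns (c + toℕ i)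
      returns′ = begin
        next^ (suc c + toℕ i) a₀   ≡⟨ fold-+ a₀ next (suc c) ⟩
        next^ (suc c) (g i)        ≡⟨ cong (next^ (suc c)) gi≡gj ⟩
        next^ (suc c) (g j)        ≡⟨ fold-+ a₀ next (suc c) ⟨
        next^ (suc (c + toℕ j)) a₀ ≡⟨ cong (λ r → next^ (suc r) a₀) c+j≡d ⟩
        next^ (suc d) a₀           ≡⟨ proj₁ d-least ⟩
        a₀                         ∎
        where open ≡-Reasoning

    g-injective : ∀ {i j} → g i ≡ g j → i ≡ j
    g-injective {i} {j} gi≡gj with <-cmp (toℕ i) (toℕ j)
    ... | tri< i<j _ _ = contradiction gi≡gj (g-injective< i<j)
    ... | tri≈ _ i≡j _ = Finₚ.toℕ-injective i≡j
    ... | tri> _ _ j<i = contradiction (sym gi≡gj) (g-injective< j<i)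

    f-injective : ∀ {i j} → f i ≡ f j → i ≡ j
    f-injective {i} {j} fi≡fj = g-injective (det (g-∈ i) (g-∈ j) fi≡fj)

    vertices-covered : ∀ v → v ∈ vs H ⇔ (∃ λ i → f i ≡ v)
    vertices-covered v = mk⇔ covered λ { (i , refl) → proj₁ (closed H (g i) (g-∈ i)) }
      where
      covered : v ∈ vs H → ∃ λ i → f i ≡ v
      covered v∈ with s , w , s⊆H ← walkIn H H-sc (proj₁ (closed H a₀ a₀∈)) v∈ =
        length s mod suc d , trans (cong (src G) (g-mod (length s))) (sym (walk-follows-next a₀∈ w s⊆H))

    arcs-covered : ∀ a → a ∈ as H ⇔ (∃ λ i → g i ≡ a)
    arcs-covered a = mk⇔ covered λ { (i , refl) → g-∈ i }
      where
      covered : a ∈ as H → ∃ λ i → g i ≡ a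
      covered a∈ with i , fi≡ ← Equivalence.to (vertices-covered (src G a)) (proj₁ (closed H a a∈)) =
        i , det (g-∈ i) a∈ fi≡

    tgt-g : ∀ i → tgt G (g i) ≡ f (suc (toℕ i) mod suc d)
    tgt-g i = trans (sym (proj₂ (next-spec (g-∈ i)))) (cong (src G) (sym (g-mod (suc (toℕ i)))))

    isDirectedCycle : IsDirectedCycle H
    isDirectedCycle = d , f , g , f-injective , g-injective , vertices-covered , arcs-covered , (λ _ → refl) , tgt-g

outDeterministic⇒directedCycle : ∀ {G} (H : SubDigraph G) → NonTrivialSC H → OutDeterministic H → IsDirectedCycle H
outDeterministic⇒directedCycle H H-sc det = isDirectedCycle (proj₁ first-return) (proj₂ first-return)
  where
  open OutDeterministic⇒Cycle H H-sc det
  first-return : ∃ (Least Returns)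
  first-return = least (λ r → next^ (suc r) a₀ Finₚ.≟ a₀) {proj₁ returns} (proj₂ returns)

-- Branching strong subdigraphs

module Branching (G : Digraph) {w a C t} (a↦w : src G a ≡ w) (C-walk : ArcWalks.ArcWalk G w w C)
  (C-nonempty : 0 < length C) (C-avoids-a : All (_≢ a) C) (t-walk : ArcWalks.ArcWalk G (tgt G a) w t) where
  open ArcWalks G
  open Words G

  Cʳ : ℕ → List Arc
  Cʳ r = concat (replicate r C)

  P Q : ℕ → List Arc
  P k = take k (Cʳ k)
  Q k = take k (a ∷ t ++ Cʳ k)

  k≤Cʳ : ∀ k → k ≤ length (Cʳ k)
  k≤Cʳ = length-concat-replicate C-nonempty

  P-word : ∀ k → Linked (P k) × length (P k) ≡ k
  P-word k = Linked-take k (_ , _ , power C-walk k) , length-take≤ k (Cʳ k) (k≤Cʳ k)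

  Q-word : ∀ k → Linked (Q k) × length (Q k) ≡ k
  Q-word k = Linked-take k (_ , _ , a ∷⟨ a↦w ⟩ ++⁺ t-walk (power C-walk k)) ,
             length-take≤ k (a ∷ t ++ Cʳ k)
               (≤-trans (k≤Cʳ k) (≤-trans (m≤n+m _ (suc (length t))) (≤-reflexive (sym (cong suc (length-++ t))))))

  slide : ∀ k → Slide k (P k) (Q k) (length (Cʳ k))
  slide k = Cʳ k ++ Q k ,
            (_ , _ , ++⁺ (power C-walk k) (proj₂ (proj₂ (proj₁ (Q-word k))))) ,
            trans (length-++ (Cʳ k)) (trans (cong (length (Cʳ k) +_) (proj₂ (Q-word k))) (+-comm _ k)) ,
            take-++ˡ k (Cʳ k) (Q k) (k≤Cʳ k) ,
            drop-++ˡ (Cʳ k) (Q k)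

  no-short-slide : ∀ k j → j < suc k → ¬ Slide (suc k) (P (suc k)) (Q (suc k)) j
  no-short-slide k j j<k (s , _ , _ , prefix , suffix) =
    All.lookup (Allₚ.take⁺ (suc k) (Allₚ.concat⁺ (Allₚ.replicate⁺ (suc k) C-avoids-a)))
               (subst (a ∈ₗ_) prefix (∈-take s suffix j<k)) refl

  innerDiam-≥ : ∀ k → ∃ λ D → InnerDiam (L^ (suc k) G) D × suc k ≤ D
  innerDiam-≥ k
    with x , x≡ ← word-onto k (proj₁ (P-word (suc k))) (proj₂ (P-word (suc k)))
       | y , y≡ ← word-onto k (proj₁ (Q-word (suc k))) (proj₂ (Q-word (suc k)))
    with D , diam ← ArcWalks.innerDiam-exists (L^ (suc k) G) x =
    D , diam ,
    innerDiamOf-≥ (ArcWalks.walk? (L^ (suc k) G)) diam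
      (slide⇒walk k _ (subst₂ (λ P′ Q′ → Slide (suc k) P′ Q′ (length (Cʳ (suc k)))) (sym x≡) (sym y≡) (slide (suc k))))
      (λ j j<k walk → no-short-slide k j j<k (subst₂ (λ P′ Q′ → Slide (suc k) P′ Q′ j) x≡ y≡ (walk⇒slide k walk)))

Branch : {G : Digraph} → SubDigraph G → Set
Branch {G} H = ∃₂ λ a b → a ∈ as H × b ∈ as H × src G a ≡ src G b × a ≢ b

branch? : ∀ {G} (H : SubDigraph G) → Dec (Branch H)
branch? H = Finₚ.any? λ a → Finₚ.any? λ b →
  (a Subsetₚ.∈? as H) ×-dec (b Subsetₚ.∈? as H) ×-dec (_ Finₚ.≟ _) ×-dec ¬? (a Finₚ.≟ b)

¬cycle⇒branch : ∀ {G} (H : SubDigraph G) → NonTrivialSC H → ¬ IsDirectedCycle H → Branch H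
¬cycle⇒branch H H-sc ¬cycle with branch? H
... | yes branch = branch
... | no  ¬branch = contradiction (outDeterministic⇒directedCycle H H-sc det) ¬cycle
  where
  det : OutDeterministic H
  det {a} {b} a∈ b∈ src≡ with a Finₚ.≟ b
  ... | yes a≡b = a≡b
  ... | no  a≢b = contradiction (a , b , a∈ , b∈ , src≡ , a≢b) ¬branch

branch⇒innerDiam-≥ : ∀ {G} (H : SubDigraph G) → NonTrivialSC H → Branch H →
                     ∀ k → ∃ λ D → InnerDiam (L^ (suc k) G) D × suc k ≤ D
branch⇒innerDiam-≥ {G} H H-sc (a₁ , a₂ , a₁∈ , a₂∈ , src≡ , a₁≢a₂)
  with t₁ , t₁-walk , t₁-avoids-w
         ← ArcWalks.firstVisit G (proj₁ (proj₂ (walkIn H H-sc (proj₂ (closed H a₁ a₁∈)) (proj₁ (closed H a₁ a₁∈)))))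
     | t₂ , t₂-walk , _
         ← walkIn H H-sc (proj₂ (closed H a₂ a₂∈)) (proj₁ (closed H a₁ a₁∈)) =
  Branching.innerDiam-≥ G (sym src≡) (ArcWalks._∷⟨_⟩_ a₁ refl t₁-walk) (s≤s z≤n)
    (a₁≢a₂ ∷ All.map (λ a↦w a≡a₂ → a↦w (trans (cong (src G) a≡a₂) (sym src≡))) t₁-avoids-w) t₂-walk

-- Periodic words

-- pump q xs repeats the p letters of xs starting at position q; unpump q
-- deletes them.  On p-periodic stretches the position q can be moved.
module Pumping {A : Set} (p : ℕ) where

  PeriodicAt : List A → ℕ → Set
  PeriodicAt xs q = head (drop q xs) ≡ head (drop (q + p) xs)

  PeriodicAt-drop : ∀ q {i} (xs : List A) → PeriodicAt xs (q + i) → PeriodicAt (drop q xs) i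
  PeriodicAt-drop q {i} xs per = begin
    head (drop i (drop q xs))       ≡⟨ cong head (drop-drop q i xs) ⟩
    head (drop (q + i) xs)          ≡⟨ per ⟩
    head (drop (q + i + p) xs)      ≡⟨ cong (λ l → head (drop l xs)) (+-assoc q i p) ⟩
    head (drop (q + (i + p)) xs)    ≡⟨ cong head (drop-drop q (i + p) xs) ⟨
    head (drop (i + p) (drop q xs)) ∎
    where open ≡-Reasoning

  pump : ℕ → List A → List A
  pump zero    xs       = take p xs ++ xs
  pump (suc q) []       = []
  pump (suc q) (x ∷ xs) = x ∷ pump q xs

  unpump : ℕ → List A → List A
  unpump zero    xs       = drop p xs
  unpump (suc q) []       = []
  unpump (suc q) (x ∷ xs) = x ∷ unpump q xs

  pump≡ : ∀ q xs → pump q xs ≡ take q xs ++ take p (drop q xs) ++ drop q xs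
  pump≡ zero    xs       = refl
  pump≡ (suc q) []       = sym (cong (_++ []) (take-[] p))
  pump≡ (suc q) (x ∷ xs) = cong (x ∷_) (pump≡ q xs)

  unpump≡ : ∀ q xs → unpump q xs ≡ take q xs ++ drop p (drop q xs)
  unpump≡ zero    xs       = refl
  unpump≡ (suc q) []       = sym (drop-[] p)
  unpump≡ (suc q) (x ∷ xs) = cong (x ∷_) (unpump≡ q xs)

  pump-step : ∀ q xs → PeriodicAt xs q → pump q xs ≡ pump (suc q) xs
  pump-step zero    []       _   = cong (_++ []) (take-[] p)
  pump-step zero    (x ∷ xs) per = rotate-take p xs per
  pump-step (suc q) []       _   = refl
  pump-step (suc q) (x ∷ xs) per = cong (x ∷_) (pump-step q xs per)

  unpump-step : ∀ q xs → PeriodicAt xs q → unpump q xs ≡ unpump (suc q) xs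
  unpump-step zero    []       _   = drop-[] p
  unpump-step zero    (x ∷ xs) per = rotate-drop p xs per
  unpump-step (suc q) []       _   = refl
  unpump-step (suc q) (x ∷ xs) per = cong (x ∷_) (unpump-step q xs per)

  pump-shift : ∀ j q xs → (∀ i → i < j → PeriodicAt xs (i + q)) → pump q xs ≡ pump (j + q) xs
  pump-shift zero    q xs _   = refl
  pump-shift (suc j) q xs per = trans (pump-shift j q xs (λ i i<j → per i (m<n⇒m<1+n i<j))) (pump-step (j + q) xs (per j ≤-refl))

  unpump-shift : ∀ j q xs → (∀ i → i < j → PeriodicAt xs (i + q)) → unpump q xs ≡ unpump (j + q) xs
  unpump-shift zero    q xs _   = refl
  unpump-shift (suc j) q xs per = trans (unpump-shift j q xs (λ i i<j → per i (m<n⇒m<1+n i<j))) (unpump-step (j + q) xs (per j ≤-refl))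

  take-pump : ∀ k q xs → q + p ≤ k → k ≤ length xs → take (k + p) (pump q xs) ≡ pump q (take k xs)
  take-pump k zero xs p≤k k≤xs = begin
    take (k + p) (take p xs ++ xs)             ≡⟨ cong (λ l → take l (take p xs ++ xs)) (+-comm k p) ⟩
    take (p + k) (take p xs ++ xs)             ≡⟨ cong (λ l → take (l + k) (take p xs ++ xs)) (length-take≤ p xs (≤-trans p≤k k≤xs)) ⟨
    take (length (take p xs) + k) (take p xs ++ xs) ≡⟨ take-length-++ (take p xs) xs k ⟩
    take p xs ++ take k xs                     ≡⟨ cong (_++ take k xs) (take-take≤ xs p≤k) ⟨
    take p (take k xs) ++ take k xs            ∎
    where open ≡-Reasoning
  take-pump (suc k) (suc q) (x ∷ xs) (s≤s q+p≤k) (s≤s k≤xs) = cong (x ∷_) (take-pump k q xs q+p≤k k≤xs)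

  take-unpump : ∀ k q xs → q + p ≤ k → take k (unpump q xs) ≡ unpump q (take (k + p) xs)
  take-unpump k zero xs _ = trans (take-drop k p xs) (cong (λ l → drop p (take l xs)) (+-comm p k))
  take-unpump (suc k) (suc q) []       _            = refl
  take-unpump (suc k) (suc q) (x ∷ xs) (s≤s q+p≤k) = cong (x ∷_) (take-unpump k q xs q+p≤k)

  drop-pump : ∀ j q xs → drop j (pump (j + q) xs) ≡ pump q (drop j xs)
  drop-pump zero    q       xs       = refl
  drop-pump (suc j) zero    []       = sym (cong (_++ []) (take-[] p))
  drop-pump (suc j) (suc q) []       = refl
  drop-pump (suc j) q       (x ∷ xs) = drop-pump j q xs

  drop-unpump : ∀ j q xs → drop j (unpump (j + q) xs) ≡ unpump q (drop j xs)
  drop-unpump zero    q       xs       = refl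
  drop-unpump (suc j) zero    []       = sym (drop-[] p)
  drop-unpump (suc j) (suc q) []       = refl
  drop-unpump (suc j) q       (x ∷ xs) = drop-unpump j q xs

  unpump-pump : ∀ q xs → q + p ≤ length xs → unpump q (pump q xs) ≡ xs
  unpump-pump zero xs p≤xs =
    trans (cong (λ l → drop l (take p xs ++ xs)) (sym (length-take≤ p xs p≤xs))) (drop-++ˡ (take p xs) xs)
  unpump-pump (suc q) (x ∷ xs) (s≤s q+p≤xs) = cong (x ∷_) (unpump-pump q xs q+p≤xs)

  pump-unpump : ∀ q xs → take p (drop q xs) ≡ take p (drop (q + p) xs) → pump q (unpump q xs) ≡ xs
  pump-unpump zero    xs       seg = trans (cong (_++ drop p xs) (sym seg)) (take++drop≡id p xs)
  pump-unpump (suc q) []       _   = refl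
  pump-unpump (suc q) (x ∷ xs) seg = cong (x ∷_) (pump-unpump q xs seg)

  length-pump : ∀ q xs → q + p ≤ length xs → length (pump q xs) ≡ length xs + p
  length-pump zero xs p≤xs = trans (length-++ (take p xs)) (trans (cong (_+ length xs) (length-take≤ p xs p≤xs)) (+-comm p _))
  length-pump (suc q) (x ∷ xs) (s≤s q+p≤xs) = cong suc (length-pump q xs q+p≤xs)

  length-unpump : ∀ q xs → q + p ≤ length xs → length (unpump q xs) + p ≡ length xs
  length-unpump zero xs p≤xs = trans (cong (_+ p) (length-drop p xs)) (m∸n+n≡m p≤xs)
  length-unpump (suc q) (x ∷ xs) (s≤s q+p≤xs) = cong suc (length-unpump q xs q+p≤xs)

  periodic⇒take≡ : ∀ m xs → (∀ i → i < m → PeriodicAt xs i) → take m xs ≡ take m (drop p xs)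
  periodic⇒take≡ zero    xs       _   = refl
  periodic⇒take≡ (suc m) []       _   = sym (cong (take (suc m)) (drop-[] p))
  periodic⇒take≡ (suc m) (x ∷ xs) per = begin
    x ∷ take m xs                        ≡⟨ cong (x ∷_) (periodic⇒take≡ m xs (λ i i<m → per (suc i) (s≤s i<m))) ⟩
    x ∷ take m (drop p xs)               ≡⟨ cong (take (suc m)) (drop-head p (x ∷ xs) (per 0 (s≤s z≤n))) ⟨
    take (suc m) (drop p (x ∷ xs))       ∎
    where open ≡-Reasoning

  periodic⇒segment≡ : ∀ q xs → (∀ i → i < p → PeriodicAt xs (q + i)) → take p (drop q xs) ≡ take p (drop (q + p) xs)
  periodic⇒segment≡ q xs per =
    trans (periodic⇒take≡ p (drop q xs) (λ i i<p → PeriodicAt-drop q xs (per i i<p))) (cong (take p) (drop-drop q p xs))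

-- A unique cycle

directedCycle⇒outDeterministic : ∀ {G} {H : SubDigraph G} → IsDirectedCycle H → OutDeterministic H
directedCycle⇒outDeterministic (_ , f , g , f-injective , _ , _ , arcs , src-g , _) a∈ b∈ src≡
  with i , refl ← Equivalence.to (arcs _) a∈ | j , refl ← Equivalence.to (arcs _) b∈ =
  cong g (f-injective (trans (sym (src-g i)) (trans src≡ (src-g j))))

module UniqueCycle {G : Digraph} (H : SubDigraph G) (H-sc : NonTrivialSC H)
  (H-unique : ∀ (H′ : SubDigraph G) → NonTrivialSC H′ → SameSub H′ H) (det : OutDeterministic H) where
  open ArcWalks G
  open Words G

  InH : List Arc → Set
  InH = All (_∈ as H)

  closedWalk⊆H : ∀ {x s} → ArcWalk x x s → 0 < length s → InH s × x ∈ vs H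
  closedWalk⊆H {x} {s} c 0<s with vs≡ , as≡ ← H-unique (span c) (span-nonTrivialSC c 0<s) =
    All.map (λ {a} → subst (a ∈_) as≡) (All∈⟦⟧ s) , subst (x ∈_) vs≡ (All.head (All∈⟦⟧ (vertices x s)))

  walk⊆H : ∀ {x y s} → x ∈ vs H → y ∈ vs H → ArcWalk x y s → InH s
  walk⊆H _  _  []                    = []
  walk⊆H x∈ y∈ w@(_ ∷⟨ _ ⟩ _) with _ , back , _ ← walkIn H H-sc y∈ x∈ =
    Allₚ.++⁻ˡ _ (proj₁ (closedWalk⊆H (++⁺ w back) (s≤s z≤n)))

  long-walk-meets-H : ∀ {u v s} → ArcWalk u v s → n G ≤ length s →
                      ∃₂ λ s₁ s₂ → ∃ λ h → h ∈ vs H × s ≡ s₁ ++ s₂ × ArcWalk u h s₁ × ArcWalk h v s₂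
  long-walk-meets-H w n≤ with c ← long⇒closedSubwalk w n≤ =
    before , cycle ++ after , _ , proj₂ (closedWalk⊆H walk-cycle cycle-nonempty) , split ,
    walk-before , ++⁺ walk-cycle walk-after
    where open ClosedSubwalk c

  walks-determined : ∀ {x z₁ z₂ t₁ t₂} → ArcWalk x z₁ t₁ → ArcWalk x z₂ t₂ → InH t₁ → InH t₂ →
                     length t₁ ≡ length t₂ → z₁ ≡ z₂
  walks-determined [] [] _ _ _ = refl
  walks-determined (a ∷⟨ a↦ ⟩ w₁) (b ∷⟨ b↦ ⟩ w₂) (a∈ ∷ t₁⊆H) (b∈ ∷ t₂⊆H) len≡
    with refl ← det a∈ b∈ (trans a↦ (sym b↦)) = walks-determined w₁ w₂ t₁⊆H t₂⊆H (suc-injective len≡)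

  a₀ : Arc
  a₀ = proj₁ (proj₂ H-sc)

  a₀∈ : a₀ ∈ as H
  a₀∈ = proj₂ (proj₂ H-sc)

  return₀ : ∃ λ t → ArcWalk (tgt G a₀) (src G a₀) t × InH t
  return₀ = walkIn H H-sc (proj₂ (closed H a₀ a₀∈)) (proj₁ (closed H a₀ a₀∈))

  -- The period: the length of a closed walk of H through a₀.
  p : ℕ
  p = suc (length (proj₁ return₀))

  H-walk-closes : ∀ {x z t} → x ∈ vs H → ArcWalk x z t → InH t → length t ≡ p → z ≡ x
  H-walk-closes {t = t} x∈ w t⊆H len≡ with r , to-x , r⊆H ← walkIn H H-sc (proj₁ (closed H a₀ a₀∈)) x∈ =
    sym (walks-determined (++⁺ (a₀ ∷⟨ refl ⟩ proj₁ (proj₂ return₀)) to-x) (++⁺ to-x w)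
                          (Allₚ.++⁺ (a₀∈ ∷ proj₂ (proj₂ return₀)) r⊆H) (Allₚ.++⁺ r⊆H t⊆H) lengths)
    where
    lengths : length ((a₀ ∷ proj₁ return₀) ++ r) ≡ length (r ++ t)
    lengths = trans (length-++ (a₀ ∷ proj₁ return₀)) (trans (+-comm p (length r))
                (trans (cong (length r +_) (sym len≡)) (sym (length-++ r))))

  -- A walk meets H within its first and within its last n G arcs, stays in
  -- H in between, and there runs around H with period p.
  periodic-middle : ∀ {u v} A {a} B {b} C → ArcWalk u v (A ++ a ∷ B ++ b ∷ C) →
                    n G ≤ length A → n G ≤ length C → suc (length B) ≡ p → a ≡ b
  periodic-middle A {a} B {b} C w n≤A n≤C len≡
    with y , A-walk , rest ← ++⁻ A w
    with z , aB-walk , b ∷⟨ b↦ ⟩ C-walk ← ++⁻ (a ∷ B) rest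
    with _  , A₂ , _ , h₁∈ , refl , _       , A₂-walk ← long-walk-meets-H A-walk n≤A
       | C₁ , _  , _ , h₂∈ , refl , C₁-walk , _       ← long-walk-meets-H C-walk n≤C =
    let middle = Allₚ.++⁻ʳ A₂ (walk⊆H h₁∈ h₂∈ (++⁺ A₂-walk (++⁺ aB-walk (b ∷⟨ b↦ ⟩ C₁-walk))))
        aB⊆H   = Allₚ.++⁻ˡ (a ∷ B) middle
        a↦y    = src-head aB-walk
        z≡y    = H-walk-closes (subst (_∈ vs H) a↦y (proj₁ (closed H a (All.head aB⊆H)))) aB-walk aB⊆H len≡
    in det (All.head aB⊆H) (All.head (Allₚ.++⁻ʳ (a ∷ B) middle)) (trans a↦y (trans (sym z≡y) (sym b↦)))

  open Pumping {Arc} p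

  linked-periodic : ∀ {t} → Linked t → ∀ q → n G ≤ q → q + p + n G < length t → PeriodicAt t q
  linked-periodic {t} (_ , _ , w) q n≤q q+p+n<t
    with a , r , drop≡  ← drop-∷ q t (≤-<-trans (≤-trans (m≤m+n q p) (m≤m+n (q + p) (n G))) q+p+n<t)
       | b , r′ , drop′≡ ← drop-∷ (q + p) t (≤-<-trans (m≤m+n (q + p) (n G)) q+p+n<t) =
    let p₁      = length (proj₁ return₀)
        drop-r  = trans (sym (cong (drop p) drop≡)) (trans (drop-drop q p t) drop′≡)
        split   = trans (sym (take++drop≡id q t))
                        (cong (take q t ++_) (trans drop≡ (cong (a ∷_) (trans (sym (take++drop≡id p₁ r)) (cong (take p₁ r ++_) drop-r)))))
        a≡b     = periodic-middle (take q t) (take p₁ r) r′ (subst (ArcWalk _ _) split w)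
                    (subst (n G ≤_) (sym (length-take≤ q t (<⇒≤ (drop-∷⇒< q t drop≡)))) n≤q)
                    (drop-∷-length (q + p) t drop′≡ q+p+n<t)
                    (cong suc (length-take≤ p₁ r (<⇒≤ (drop-∷⇒< p₁ r drop-r))))
    in trans (cong head drop≡) (trans (cong just a≡b) (sym (cong head drop′≡)))

  periodic-split : ∀ {u v s} q → ArcWalk u v s → PeriodicAt s q → q + p < length s →
                   ∃ λ y → ArcWalk u y (take q s) × ArcWalk y y (take p (drop q s)) ×
                           ArcWalk y v (drop q s) × ArcWalk y v (drop p (drop q s))
  periodic-split {s = s} q w per q+p<s
    with y , before , after ← splitAt q w
    with z , segment , rest ← splitAt p after
    with a , _ , drop≡  ← drop-∷ q s (≤-<-trans (m≤m+n q p) q+p<s)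
       | b , _ , drop′≡ ← drop-∷ (q + p) s q+p<s =
    let a≡b = just-injective (trans (sym (cong head drop≡)) (trans per (cong head drop′≡)))
        a↦y = src-head (subst (ArcWalk y _) drop≡ after)
        b↦z = src-head (subst (ArcWalk z _) (trans (drop-drop q p s) drop′≡) rest)
        z≡y = trans (sym b↦z) (trans (cong (src G) (sym a≡b)) a↦y)
    in y , before , subst (λ x → ArcWalk y x _) z≡y segment , after , subst (λ x → ArcWalk x _ _) z≡y rest

  pump-linked : ∀ {s} q → Linked s → PeriodicAt s q → q + p < length s → Linked (pump q s)
  pump-linked {s} q (u , v , w) per q+p<s with _ , before , segment , after , _ ← periodic-split q w per q+p<s =
    u , v , subst (ArcWalk u v) (sym (pump≡ q s)) (++⁺ before (++⁺ segment after))

  unpump-linked : ∀ {s} q → Linked s → PeriodicAt s q → q + p < length s → Linked (unpump q s)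
  unpump-linked {s} q (u , v , w) per q+p<s with _ , before , _ , _ , rest ← periodic-split q w per q+p<s =
    u , v , subst (ArcWalk u v) (sym (unpump≡ q s)) (++⁺ before rest)

  margin : ℕ
  margin = n G + p + n G

  slide-periodic : ∀ {s k j} → Linked s → length s ≡ k + j → margin < k → ∀ i → i ≤ j → PeriodicAt s (i + n G)
  slide-periodic {s} {k} {j} lk len margin<k i i≤j = linked-periodic lk (i + n G) (m≤n+m (n G) i) (begin-strict
    i + n G + p + n G   ≡⟨ trans (cong (_+ n G) (+-assoc i (n G) p)) (+-assoc i (n G + p) (n G)) ⟩
    i + margin          <⟨ +-mono-≤-< i≤j margin<k ⟩
    j + k               ≡⟨ +-comm j k ⟩
    k + j               ≡⟨ len ⟨
    length s            ∎)
    where open ≤-Reasoning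

  n+p<margin : ∀ {k} → margin < k → n G + p < k
  n+p<margin = ≤-<-trans (m≤m+n (n G + p) (n G))

  pump-slide : ∀ {k P Q j} → margin < k → Slide k P Q j → Slide (k + p) (pump (n G) P) (pump (n G) Q) j
  pump-slide {k} {P} {Q} {j} margin<k (s , lk , len , prefix , suffix) =
    pump (n G) s , pump-linked (n G) lk (per 0 z≤n) n+p<s , length≡ , prefix′ , suffix′
    where
    per : ∀ i → i ≤ j → PeriodicAt s (i + n G)
    per = slide-periodic lk len margin<k
    k≤s : k ≤ length s
    k≤s = ≤-trans (m≤m+n k j) (≤-reflexive (sym len))
    n+p<s : n G + p < length s
    n+p<s = ≤-trans (n+p<margin margin<k) k≤s
    length≡ : length (pump (n G) s) ≡ k + p + j
    length≡ = trans (length-pump (n G) s (<⇒≤ n+p<s))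
                (trans (cong (_+ p) len) (trans (+-assoc k j p) (trans (cong (k +_) (+-comm j p)) (sym (+-assoc k p j)))))
    prefix′ : take (k + p) (pump (n G) s) ≡ pump (n G) P
    prefix′ = trans (take-pump k (n G) s (<⇒≤ (n+p<margin margin<k)) k≤s) (cong (pump (n G)) prefix)
    suffix′ : drop j (pump (n G) s) ≡ pump (n G) Q
    suffix′ = begin
      drop j (pump (n G) s)       ≡⟨ cong (drop j) (pump-shift j (n G) s (λ i i<j → per i (<⇒≤ i<j))) ⟩
      drop j (pump (j + n G) s)   ≡⟨ drop-pump j (n G) s ⟩
      pump (n G) (drop j s)       ≡⟨ cong (pump (n G)) suffix ⟩
      pump (n G) Q                ∎
      where open ≡-Reasoning

  unpump-slide : ∀ {k P Q j} → margin < k → length P ≡ k → length Q ≡ k →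
                 Slide (k + p) (pump (n G) P) (pump (n G) Q) j → Slide k P Q j
  unpump-slide {k} {P} {Q} {j} margin<k |P| |Q| (t , lk , len , prefix , suffix) =
    unpump (n G) t , unpump-linked (n G) lk (per 0 z≤n) n+p<t , length≡ , prefix′ , suffix′
    where
    n+p≤k : n G + p ≤ k
    n+p≤k = <⇒≤ (n+p<margin margin<k)
    per : ∀ i → i ≤ j → PeriodicAt t (i + n G)
    per = slide-periodic lk len (≤-trans margin<k (m≤m+n k p))
    n+p<t : n G + p < length t
    n+p<t = ≤-trans (n+p<margin margin<k) (≤-trans (m≤m+n k p) (≤-trans (m≤m+n (k + p) j) (≤-reflexive (sym len))))
    length≡ : length (unpump (n G) t) ≡ k + j
    length≡ = +-cancelʳ-≡ p _ _ (trans (length-unpump (n G) t (<⇒≤ n+p<t))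
                (trans len (trans (+-assoc k p j) (trans (cong (k +_) (+-comm p j)) (sym (+-assoc k j p))))))
    prefix′ : take k (unpump (n G) t) ≡ P
    prefix′ = begin
      take k (unpump (n G) t)             ≡⟨ take-unpump k (n G) t n+p≤k ⟩
      unpump (n G) (take (k + p) t)       ≡⟨ cong (unpump (n G)) prefix ⟩
      unpump (n G) (pump (n G) P)         ≡⟨ unpump-pump (n G) P (≤-trans n+p≤k (≤-reflexive (sym |P|))) ⟩
      P                                   ∎
      where open ≡-Reasoning
    suffix′ : drop j (unpump (n G) t) ≡ Q
    suffix′ = begin
      drop j (unpump (n G) t)             ≡⟨ cong (drop j) (unpump-shift j (n G) t (λ i i<j → per i (<⇒≤ i<j))) ⟩
      drop j (unpump (j + n G) t)         ≡⟨ drop-unpump j (n G) t ⟩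
      unpump (n G) (drop j t)             ≡⟨ cong (unpump (n G)) suffix ⟩
      unpump (n G) (pump (n G) Q)         ≡⟨ unpump-pump (n G) Q (≤-trans n+p≤k (≤-reflexive (sym |Q|))) ⟩
      Q                                   ∎
      where open ≡-Reasoning

  wordDiam-periodic : ∀ k → margin < k → ∀ D → InnerDiamOf (SlideWord k) D ⇔ InnerDiamOf (SlideWord (k + p)) D
  wordDiam-periodic k margin<k = innerDiamOf-cong (λ P T → pump (n G) (proj₁ P) ≡ proj₁ T) pumped unpumped
    λ { {P} {P′} refl refl j → mk⇔ (pump-slide margin<k) (unpump-slide margin<k (proj₂ (proj₂ P)) (proj₂ (proj₂ P′))) }
    where
    pumped : ∀ (P : Word k) → ∃ λ (T : Word (k + p)) → pump (n G) (proj₁ P) ≡ proj₁ T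
    pumped (P , lk , len) =
      (pump (n G) P , pump-linked (n G) lk (slide-periodic lk (trans len (sym (+-identityʳ k))) margin<k 0 z≤n) n+p<P ,
       trans (length-pump (n G) P (<⇒≤ n+p<P)) (cong (_+ p) len)) , refl
      where
      n+p<P : n G + p < length P
      n+p<P = ≤-trans (n+p<margin margin<k) (≤-reflexive (sym len))
    unpumped : ∀ (T : Word (k + p)) → ∃ λ (P : Word k) → pump (n G) (proj₁ P) ≡ proj₁ T
    unpumped (T , lk , len) =
      (unpump (n G) T , unpump-linked (n G) lk (per 0 z≤n) n+p<T ,
       +-cancelʳ-≡ p _ _ (trans (length-unpump (n G) T (<⇒≤ n+p<T)) len)) ,
      pump-unpump (n G) T (periodic⇒segment≡ (n G) T λ i i<p → subst (PeriodicAt T) (+-comm i (n G)) (per i (<⇒≤ i<p)))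
      where
      per : ∀ i → i ≤ p → PeriodicAt T (i + n G)
      per = slide-periodic lk len margin<k
      n+p<T : n G + p < length T
      n+p<T = ≤-trans (n+p<margin margin<k) (≤-trans (m≤m+n k p) (≤-reflexive (sym len)))

  innerDiam-periodic : ∀ k → margin < k → ∀ D → InnerDiam (L^ k G) D ⇔ InnerDiam (L^ (k + p) G) D
  innerDiam-periodic (suc k) margin<k D =
    ⇔-sym (innerDiam⇔wordDiam (k + p) D) ⇔-∘ (wordDiam-periodic (suc k) margin<k D ⇔-∘ innerDiam⇔wordDiam k D)

¬cycle⇒innerDiam-unbounded : ∀ {G} (H : SubDigraph G) → NonTrivialSC H → ¬ IsDirectedCycle H →
                             ∀ M → ∃ λ K → ∀ k → K ≤ k → ∃ λ D → InnerDiam (L^ k G) D × M ≤ D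
¬cycle⇒innerDiam-unbounded {G} H H-sc ¬cycle M = suc M , bound
  where
  bound : ∀ k → suc M ≤ k → ∃ λ D → InnerDiam (L^ k G) D × M ≤ D
  bound (suc k) (s≤s M≤k) = proj₁ big , proj₁ (proj₂ big) , ≤-trans M≤k (<⇒≤ (proj₂ (proj₂ big)))
    where
    big : ∃ λ D → InnerDiam (L^ (suc k) G) D × suc k ≤ D
    big = branch⇒innerDiam-≥ H H-sc (¬cycle⇒branch H H-sc ¬cycle) k

proposition5 : (G : Digraph) → ¬ StronglyConnected G →
      -- (i)
      ((∀ (H : SubDigraph G) → ¬ NonTrivialSC H) →
        ∃ λ h → InnerDiam (L^ h G) 0 × (∀ k → h < k → EmptyDigraph (L^ k G)))
      -- (ii.a)
    × ((H : SubDigraph G) → NonTrivialSC H →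
        (∀ (H' : SubDigraph G) → NonTrivialSC H' → SameSub H' H) →
        IsDirectedCycle H →
        ∃ λ N → ∃ λ p → 0 < p ×
          (∀ k → N ≤ k → ∀ D → InnerDiam (L^ k G) D ⇔ InnerDiam (L^ (k + p) G) D))
      -- (ii.b)
    × ((H : SubDigraph G) → NonTrivialSC H → ¬ IsDirectedCycle H →
        ∀ M → ∃ λ K → ∀ k → K ≤ k → ∃ λ D → InnerDiam (L^ k G) D × M ≤ D)
proposition5 G ¬sc =
  (λ acyclic → Acyclic.eventually-empty G acyclic (vertex-of-¬stronglyConnected G ¬sc)) ,
  (λ H H-sc H-unique H-cycle →
     let open UniqueCycle H H-sc H-unique (directedCycle⇒outDeterministic {H = H} H-cycle)
     in suc margin , p , s≤s z≤n , innerDiam-periodic) ,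
  ¬cycle⇒innerDiam-unbounded
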